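{- Let $G$ be a finite graph each of whose connected components is a tree or a unicyclic graph. Then in the on-line list colouring game on $G$, Mrs. Correct has a winning strategy using $1$ eraser at each vertex of the tree components and $2$ erasers at each vertex of the unicyclic components.
   Context: A unicyclic graph is a connected graph containing exactly one cycle. The on-line list colouring game between Mr. Paint and Mrs. Correct on $G$, with a given number of erasers at each vertex, is played as follows: in each round Mr. Paint selects a subset of the (remaining) vertices and paints them with a new colour (never used before); Mrs. Correct then erases the colour from some of these vertices so that no two adjacent vertices keep the same colour, each erasure at a vertex using up one eraser at that vertex (she cannot erase at a vertex with no erasers left). Vertices whose colour is not erased are permanently coloured and removed. Mrs. Correct wins if all vertices become permanently coloured; Mr. Paint wins if at some point he presents two adjacent vertices neither of which has any eraser left. -}

module Defs where

open import Data.Nat using (ℕ; _≤_; _∸_)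
open import Data.Fin using (Fin)
open import Data.Fin.Subset using (Subset; _∈_; _⊆_; _─_; Nonempty; ⊤)
open import Data.Vec using (lookup)
open import Data.Bool using (if_then_else_)
open import Data.List using (List; []; _∷_; _++_; [_]; length)
open import Data.List.Relation.Unary.Linked using (Linked)
open import Data.List.Relation.Unary.Unique.Propositional using (Unique)
open import Data.Product using (Σ; ∃; _×_)
open import Data.Sum using (_⊎_)
open import Data.Empty using (⊥)
open import Relation.Nullary using (¬_)
open import Relation.Unary using (Decidable)
open import Relation.Binary.Construct.Closure.ReflexiveTransitive using (Star)
import Relation.Binary as B

record Graph (n : ℕ) : Set₁ where
  field
    Adj     : Fin n → Fin n → Set
    adj?    : B.Decidable Adj
    sym     : ∀ {u v} → Adj u v → Adj v u
    irrefl  : ∀ {v} → ¬ Adj v v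

module _ {n : ℕ} (G : Graph n) where
  open Graph G

  Reach : Fin n → Fin n → Set
  Reach = Star Adj

  record Cycle : Set where
    constructor cycle
    field
      start   : Fin n
      rest    : List (Fin n)
      long    : 2 ≤ length rest
      distinct : Unique (start ∷ rest)
      closed  : Linked Adj (start ∷ rest ++ [ start ])

  data Consec {A : Set} : List A → A → A → Set where
    here  : ∀ {x y l} → Consec (x ∷ y ∷ l) x y
    there : ∀ {z x y l} → Consec l x y → Consec (z ∷ l) x y

  CycleEdge : Cycle → Fin n → Fin n → Set
  CycleEdge c x y =
    Consec (Cycle.start c ∷ Cycle.rest c ++ [ Cycle.start c ]) x y
    ⊎ Consec (Cycle.start c ∷ Cycle.rest c ++ [ Cycle.start c ]) y x

  -- two cycles are the same cycle (same subgraph) iff they have the same edges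
  SameCycle : Cycle → Cycle → Set
  SameCycle c d = ∀ x y → (CycleEdge c x y → CycleEdge d x y)
                        × (CycleEdge d x y → CycleEdge c x y)

  CycleIn : Fin n → Cycle → Set
  CycleIn r c = Reach r (Cycle.start c)

  TreeComponent : Fin n → Set
  TreeComponent r = ¬ Σ Cycle (CycleIn r)

  UnicyclicComponent : Fin n → Set
  UnicyclicComponent r =
    Σ Cycle λ c → CycleIn r c × (∀ d → CycleIn r d → SameCycle c d)

  -- The on-line list colouring game (Mr. Paint / Mrs. Correct).
  -- A position is the set R of not yet permanently coloured vertices
  -- together with the number of erasers e v left at each vertex.

  Independent : Subset n → Set
  Independent S = ∀ u v → u ∈ S → v ∈ S → ¬ Adj u v

  useErasers : Subset n → (Fin n → ℕ) → Fin n → ℕ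
  useErasers E e v = if lookup E v then e v ∸ 1 else e v

  -- Mrs. Correct has a winning strategy from position (R , e):
  -- for every nonempty set P ⊆ R that Mr. Paint paints, she can choose a
  -- set E ⊆ P of vertices to erase, each having an eraser left, such that
  -- the permanently coloured vertices P ─ E are independent, and she
  -- again has a winning strategy from the resulting position.
  -- (Inductive: the game ends after finitely many rounds; when R is empty
  -- all vertices are permanently coloured and she has won.)
  data CorrectWins (R : Subset n) (e : Fin n → ℕ) : Set where
    step : (∀ (P : Subset n) → P ⊆ R → Nonempty P →
              Σ (Subset n) λ E →
                E ⊆ P
              × (∀ v → v ∈ E → 1 ≤ e v)
              × Independent (P ─ E)
              × CorrectWins (R ─ (P ─ E)) (useErasers E e))
         → CorrectWins R e

module Submission where

-- Idea: such a graph is e-degenerate, i.e. every nonempty vertex set S has a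
-- vertex with at most e v neighbours inside S.  Otherwise all degrees in S
-- exceed e v >= 1, so S contains a cycle; its component is then unicyclic,
-- all degrees in S are at least three, and deleting one edge of the cycle
-- still leaves a cycle, contradicting uniqueness.  Peeling low-degree
-- vertices one at a time gives peeling times t such that every vertex has at
-- most e v neighbours peeled after it.  In each round Mrs. Correct keeps the
-- painted vertices greedily in decreasing t (skipping those with an already
-- kept neighbour); an erased vertex thereby loses both an eraser and a later
-- uncoloured neighbour, so "at most e v later uncoloured neighbours" is
-- invariant, and the total number of uncoloured vertices plus erasers drops.

open import Defs
open import Data.Bool using (true; false)
open import Data.Nat using (ℕ; zero; suc; _+_; _∸_; _≤_; _<_; _≤?_; _<?_; z≤n; s≤s; s≤s⁻¹)
open import Data.Nat.Properties
  using (≤-refl; ≤-reflexive; ≤-trans; <-≤-trans; ≰⇒>; <⇒≱; ≤∧≢⇒<; n≮0; n≤1+n; suc-injective;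
         +-suc; m<m+n; m∸n≤m; +-mono-≤; +-mono-<-≤; +-mono-≤-<)
open import Data.Nat.Induction using (<-wellFounded)
open import Data.Fin using (Fin; zero; suc; _≟_)
open import Data.Fin.Properties using (any?; injective⇒≤)
open import Data.Fin.Subset
  using (Subset; _∈_; _∉_; _⊆_; _⊂_; _─_; _-_; _∪_; ⁅_⁆; ∣_∣; Nonempty; inside; outside; ⊤)
  renaming (⊥ to ∅)
open import Data.Fin.Subset.Properties
  using (_∈?_; nonempty?; Empty-unique; ∈⊤; ∉⊥; ∣⊥∣≡0; x∈⁅x⁆; x∈⁅y⁆⇒x≡y; x∉⁅y⁆⇒x≢y; ∣⁅x⁆∣≡1;
         p⊆q⇒∣p∣≤∣q∣; p⊂q⇒∣p∣<∣q∣; p─⊥≡p; p─q⊆p; x∈p∧x∉q⇒x∈p─q; x∈p∧x≢y⇒x∈p-y; x∈p⇒p-x⊂p;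
         x∈p∪q⁻; p⊆p∪q; q⊆p∪q)
open import Data.Fin.Subset.Induction using (Acc; acc; ⊂-wellFounded)
open import Data.Vec using ([]; _∷_; here; there)
import Data.Vec as Vec
open import Data.Vec.Properties using ([]=⇒lookup; lookup⇒[]=)
open import Data.List using (List; []; _∷_; _++_; [_]; length; lookup)
open import Data.List.Relation.Unary.Any using (here; there)
open import Data.List.Relation.Unary.All as All using (All; []; _∷_)
open import Data.List.Relation.Unary.All.Properties using (++⁻; ¬Any⇒All¬)
open import Data.List.Relation.Unary.Unique.Propositional using (Unique; []; _∷_)
open import Data.List.Relation.Unary.Linked as Linked using (Linked; []; [-]; _∷_)
open import Data.List.Membership.Propositional using () renaming (_∈_ to _∈ₗ_)
open import Data.List.Membership.Propositional.Properties using (∈-∃++; ∈-lookup)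
open import Data.Product using (Σ; ∃; ∃₂; _×_; _,_; proj₁; proj₂)
open import Data.Sum using (_⊎_; inj₁; inj₂)
open import Data.Empty using (⊥; ⊥-elim)
open import Function using (id; _∘_)
open import Relation.Nullary using (¬_; Dec; yes; no; contradiction)
open import Relation.Nullary.Decidable using (isYes; _×-dec_)
open import Relation.Unary using (Decidable)
open import Relation.Binary.PropositionalEquality
  using (_≡_; _≢_; refl; sym; trans; cong; subst; subst₂; ≢-sym)
open import Relation.Binary.Construct.Closure.ReflexiveTransitive using (ε; _◅_; _◅◅_; reverse)

select : ∀ {n} {P : Fin n → Set} → Decidable P → Subset n
select {zero}  P? = []
select {suc n} P? = isYes (P? zero) ∷ select (P? ∘ suc)

select⁺ : ∀ {n} {P : Fin n → Set} (P? : Decidable P) {x} → P x → x ∈ select P?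
select⁺ P? {zero} px with P? zero
... | yes _  = here
... | no ¬px = contradiction px ¬px
select⁺ P? {suc x} px = there (select⁺ (P? ∘ suc) px)

select⁻ : ∀ {n} {P : Fin n → Set} (P? : Decidable P) {x} → x ∈ select P? → P x
select⁻ P? {zero} x∈ with P? zero | x∈
... | yes px | _ = px
... | no _   | ()
select⁻ P? {suc x} (there x∈) = select⁻ (P? ∘ suc) x∈

x∈p─q⇒x∉q : ∀ {n} {p q : Subset n} {x} → x ∈ p ─ q → x ∉ q
x∈p─q⇒x∉q {p = _ ∷ p} {inside ∷ q}  ()         here
x∈p─q⇒x∉q {p = _ ∷ p} {inside ∷ q}  (there x∈) (there x∈q) = x∈p─q⇒x∉q x∈ x∈q
x∈p─q⇒x∉q {p = _ ∷ p} {outside ∷ q} (there x∈) (there x∈q) = x∈p─q⇒x∉q x∈ x∈q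

∣p∣≤1+∣p-x∣ : ∀ {n} (p : Subset n) x → ∣ p ∣ ≤ suc ∣ p - x ∣
∣p∣≤1+∣p-x∣ (inside ∷ p) zero = ≤-reflexive (cong (suc ∘ ∣_∣) (sym (p─⊥≡p p)))
∣p∣≤1+∣p-x∣ (outside ∷ p) zero = ≤-trans (n≤1+n _) (≤-reflexive (cong (suc ∘ ∣_∣) (sym (p─⊥≡p p))))
∣p∣≤1+∣p-x∣ (inside ∷ p) (suc x) = s≤s (∣p∣≤1+∣p-x∣ p x)
∣p∣≤1+∣p-x∣ (outside ∷ p) (suc x) = ∣p∣≤1+∣p-x∣ p x

x∈p⇒0<∣p∣ : ∀ {n} {p : Subset n} {x} → x ∈ p → 0 < ∣ p ∣
x∈p⇒0<∣p∣ {p = p} {x} x∈p = subst (_≤ ∣ p ∣) (∣⁅x⁆∣≡1 x) (p⊆q⇒∣p∣≤∣q∣ ⁅x⁆⊆p)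
  where
  ⁅x⁆⊆p : ⁅ x ⁆ ⊆ p
  ⁅x⁆⊆p y∈ = subst (_∈ p) (sym (x∈⁅y⁆⇒x≡y x y∈)) x∈p

0<∣p∣⇒Nonempty : ∀ {n} (p : Subset n) → 0 < ∣ p ∣ → Nonempty p
0<∣p∣⇒Nonempty {n} p 0<∣p∣ with nonempty? p
... | yes ne = ne
... | no empty = contradiction 0<∣⊥∣ (n≮0 {0})
  where
  0<∣⊥∣ : 0 < 0
  0<∣⊥∣ = subst (0 <_) (∣⊥∣≡0 n) (subst (λ q → 0 < ∣ q ∣) (Empty-unique empty) 0<∣p∣)

avoid : ∀ {n} (A : Subset n) (xs : List (Fin n)) → length xs < ∣ A ∣ → ∃ λ w → w ∈ A × All (w ≢_) xs
avoid A []       big = let w , w∈A = 0<∣p∣⇒Nonempty A big in w , w∈A , []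
avoid A (x ∷ xs) big with avoid (A - x) xs (s≤s⁻¹ (≤-trans big (∣p∣≤1+∣p-x∣ A x)))
... | w , w∈A-x , w∉xs = w , p─q⊆p A ⁅ x ⁆ w∈A-x , x∉⁅y⁆⇒x≢y (x∈p─q⇒x∉q w∈A-x) ∷ w∉xs

lookup-injective : ∀ {A : Set} {xs : List A} → Unique xs → ∀ {i j} → lookup xs i ≡ lookup xs j → i ≡ j
lookup-injective (x∉xs ∷ _) {zero}  {zero}  _  = refl
lookup-injective (x∉xs ∷ _) {zero}  {suc j} eq = contradiction eq (All.lookup x∉xs (∈-lookup j))
lookup-injective (x∉xs ∷ _) {suc i} {zero}  eq = contradiction (sym eq) (All.lookup x∉xs (∈-lookup i))
lookup-injective (_ ∷ u)    {suc i} {suc j} eq = cong suc (lookup-injective u eq)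

length-unique≤ : ∀ {n} {xs : List (Fin n)} → Unique xs → length xs ≤ n
length-unique≤ u = injective⇒≤ (lookup-injective u)

Linked-prefix : ∀ {A : Set} {R : A → A → Set} (xs : List A) {a ys} → Linked R (xs ++ a ∷ ys) → Linked R (xs ++ [ a ])
Linked-prefix []           _       = [-]
Linked-prefix (x ∷ [])     (r ∷ _) = r ∷ [-]
Linked-prefix (x ∷ y ∷ xs) (r ∷ l) = r ∷ Linked-prefix (y ∷ xs) l

Unique-rotate : ∀ {A : Set} (xs : List A) {a ys} → Unique (xs ++ a ∷ ys) → Unique (a ∷ xs)
Unique-rotate []       _           = [] ∷ []
Unique-rotate (x ∷ xs) (x∉ ∷ u) with ++⁻ xs x∉ | Unique-rotate xs u
... | x∉xs , x≢a ∷ _ | a∉xs ∷ uxs = (≢-sym x≢a ∷ a∉xs) ∷ x∉xs ∷ uxs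

<⇒≤∸1 : ∀ {m n} → m < n → m ≤ n ∸ 1
<⇒≤∸1 (s≤s m≤n) = m≤n

∸1< : ∀ {n} → 1 ≤ n → n ∸ 1 < n
∸1< {suc n} _ = ≤-refl

total : ∀ {m} → (Fin m → ℕ) → ℕ
total {zero}  f = 0
total {suc m} f = f zero + total (f ∘ suc)

total-mono : ∀ {m} {f g : Fin m → ℕ} → (∀ i → f i ≤ g i) → total f ≤ total g
total-mono {zero}  f≤g = z≤n
total-mono {suc m} f≤g = +-mono-≤ (f≤g zero) (total-mono (f≤g ∘ suc))

total-strict : ∀ {m} {f g : Fin m → ℕ} → (∀ i → f i ≤ g i) → ∀ j → f j < g j → total f < total g
total-strict f≤g zero    f<g = +-mono-<-≤ f<g (total-mono (f≤g ∘ suc))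
total-strict f≤g (suc j) f<g = +-mono-≤-< (f≤g zero) (total-strict (f≤g ∘ suc) j f<g)

module Neighbours {n : ℕ} (G : Graph n) where
  open Graph G using (adj?)

  Nbrs : Subset n → Fin n → Subset n
  Nbrs S v = select (λ u → (u ∈? S) ×-dec adj? v u)

  deg : Subset n → Fin n → ℕ
  deg S v = ∣ Nbrs S v ∣

  Degenerate : (Fin n → ℕ) → Set
  Degenerate e = ∀ S → Nonempty S → ∃ λ v → v ∈ S × deg S v ≤ e v

-- Finding cycles: a walk that never turns back must eventually revisit a vertex.
module CycleSearch {n : ℕ} (G : Graph n) where
  open Graph G using (Adj; irrefl)
  open import Data.List.Membership.DecPropositional (_≟_ {n}) using () renaming (_∈?_ to _∈ₗ?_)

  Linked⇒Consec : ∀ {R : Fin n → Fin n → Set} {zs a b} → Linked R zs → Consec G zs a b → R a b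
  Linked⇒Consec (r ∷ _) here      = r
  Linked⇒Consec (_ ∷ l) (there c) = Linked⇒Consec l c

  HCycle : (Fin n → Fin n → Set) → Fin n → Set
  HCycle H v0 = Σ (Cycle G) λ c → CycleIn G v0 c × (∀ a b → CycleEdge G c a b → H a b)

  -- H is the edge relation of a spanning subgraph; S is a vertex set on which
  -- that subgraph has minimum degree two near v0: every vertex of S in the
  -- component of v0 has an H-neighbour in S other than any prescribed vertex p.
  module _ (H : Fin n → Fin n → Set) (H⇒Adj : ∀ {x y} → H x y → Adj x y) (H-sym : ∀ {x y} → H x y → H y x)
           (S : Subset n) (v0 : Fin n)
           (branch : ∀ {v} → v ∈ S → Reach G v0 v → ∀ p → ∃ λ w → w ∈ S × H v w × w ≢ p) where

    -- A trail x ∷ y ∷ ys (newest vertex first) whose head x has an H-neighbour w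
    -- further back in the trail closes up into the cycle w, x, y, ..., w.
    close : ∀ {x y ys w} → Unique (x ∷ y ∷ ys) → Linked H (x ∷ y ∷ ys) → Reach G v0 x →
            H x w → w ∈ₗ ys → HCycle H v0
    close {x} {y} {w = w} u lk rx xw w∈ys with ∈-∃++ w∈ys
    ... | pre , post , refl = c , rx ◅◅ (H⇒Adj xw ◅ ε) , edges
      where
      closed : Linked H (w ∷ x ∷ y ∷ pre ++ [ w ])
      closed = H-sym xw ∷ Linked-prefix (x ∷ y ∷ pre) lk
      distinct : Unique (w ∷ x ∷ y ∷ pre)
      distinct = Unique-rotate (x ∷ y ∷ pre) u
      c : Cycle G
      c = cycle w (x ∷ y ∷ pre) (s≤s (s≤s z≤n)) distinct (Linked.map H⇒Adj closed)
      edges : ∀ a b → CycleEdge G c a b → H a b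
      edges a b (inj₁ ab) = Linked⇒Consec closed ab
      edges a b (inj₂ ba) = H-sym (Linked⇒Consec closed ba)

    -- Extend the trail at its head, never returning to the previous vertex, until
    -- it meets itself; a duplicate-free trail has at most n vertices, so the
    -- fuel bound guarantees this happens.
    walk : (fuel : ℕ) {x y : Fin n} {ys : List (Fin n)} → n < fuel + length (x ∷ y ∷ ys) →
           Unique (x ∷ y ∷ ys) → Linked H (x ∷ y ∷ ys) → x ∈ S → Reach G v0 x → HCycle H v0
    walk zero         bound u _  _   _  = contradiction (length-unique≤ u) (<⇒≱ bound)
    walk (suc fuel) {x} {y} {ys} bound u lk x∈S rx with branch x∈S rx y
    ... | w , w∈S , xw , w≢y with w ∈ₗ? (x ∷ y ∷ ys)
    ...   | yes (here w≡x)           = contradiction (H⇒Adj (subst (H x) w≡x xw)) irrefl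
    ...   | yes (there (here w≡y))   = contradiction w≡y w≢y
    ...   | yes (there (there w∈ys)) = close u lk rx xw w∈ys
    ...   | no w∉trail = walk fuel (subst (n <_) (sym (+-suc fuel _)) bound)
                              (¬Any⇒All¬ _ w∉trail ∷ u) (H-sym xw ∷ lk) w∈S (rx ◅◅ (H⇒Adj xw ◅ ε))

    cycle-from-branching : v0 ∈ S → HCycle H v0
    cycle-from-branching v0∈S with branch v0∈S ε v0
    ... | w , w∈S , v0w , w≢v0 =
      walk n (m<m+n n (s≤s z≤n)) ((w≢v0 ∷ []) ∷ [] ∷ []) (H-sym v0w ∷ [-]) w∈S (H⇒Adj v0w ◅ ε)

cycle-edge : ∀ {n} (G : Graph n) (c : Cycle G) → ∃₂ λ a b → Graph.Adj G a b × CycleEdge G c a b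
cycle-edge G (cycle a []      () _ _)
cycle-edge G (cycle a (b ∷ _) _  _ (ab ∷ _)) = a , b , ab , inj₁ here

SameEdge : ∀ {n} → Fin n → Fin n → Fin n → Fin n → Set
SameEdge a b x y = (x ≡ a × y ≡ b) ⊎ (x ≡ b × y ≡ a)

module SparseComponents {n : ℕ} (G : Graph n)
  (components : ∀ v → TreeComponent G v ⊎ UnicyclicComponent G v)
  (e : Fin n → ℕ) (e≥1 : ∀ v → 1 ≤ e v) (e≥2 : ∀ v → UnicyclicComponent G v → 2 ≤ e v) where
  open Graph G using (Adj; irrefl) renaming (sym to Adj-sym)
  open CycleSearch G
  open Neighbours G

  -- A vertex whose component contains a cycle lies in a unicyclic component.
  cyclic⇒e≥2 : ∀ {v} (c : Cycle G) → CycleIn G v c → 2 ≤ e v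
  cyclic⇒e≥2 {v} c v~c with components v
  ... | inj₁ tree = contradiction (c , v~c) tree
  ... | inj₂ uni  = e≥2 v uni

  neighbour-avoiding : ∀ S v (ps : List (Fin n)) → length ps < deg S v →
                       ∃ λ w → w ∈ S × Adj v w × All (w ≢_) ps
  neighbour-avoiding S v ps big with avoid (Nbrs S v) ps big
  ... | w , w∈N , w∉ps = let w∈S , vw = select⁻ _ w∈N in w , w∈S , vw , w∉ps

  -- A nonempty set S in which every vertex v has more than e v neighbours
  -- cannot exist: S contains a cycle, so the component of v0 is unicyclic;
  -- deleting an edge ab of that cycle still leaves a cycle, which by
  -- uniqueness is the same cycle and hence contains ab.
  module Dense (S : Subset n) (v0 : Fin n) (v0∈S : v0 ∈ S) (dense : ∀ {v} → v ∈ S → e v < deg S v) where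

    -- all degrees in S are at least two, so S contains a cycle near v0
    first-cycle : HCycle Adj v0
    first-cycle = cycle-from-branching Adj id Adj-sym S v0 branch v0∈S
      where
      branch : ∀ {v} → v ∈ S → Reach G v0 v → ∀ p → ∃ λ w → w ∈ S × Adj v w × w ≢ p
      branch {v} v∈S _ p with neighbour-avoiding S v [ p ] (≤-trans (s≤s (e≥1 v)) (dense v∈S))
      ... | w , w∈S , vw , w≢p ∷ [] = w , w∈S , vw , w≢p

    module WithoutEdge (a b : Fin n) (a≢b : a ≢ b) (e≥2-near : ∀ {v} → Reach G v0 v → 2 ≤ e v) where

      Other : Fin n → Fin n → Set
      Other x y = Adj x y × ¬ SameEdge a b x y

      Other-sym : ∀ {x y} → Other x y → Other y x
      Other-sym (xy , ¬same) = Adj-sym xy , ¬same ∘ swap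
        where
        swap : ∀ {x y} → SameEdge a b y x → SameEdge a b x y
        swap (inj₁ (y≡a , x≡b)) = inj₂ (x≡b , y≡a)
        swap (inj₂ (y≡b , x≡a)) = inj₁ (x≡a , y≡b)

      partner : ∀ v → ∃ λ q → ∀ {w} → w ≢ q → ¬ SameEdge a b v w
      partner v with v ≟ a
      ... | yes v≡a = b , λ { w≢b (inj₁ (_ , w≡b)) → w≢b w≡b
                            ; _   (inj₂ (v≡b , _)) → a≢b (trans (sym v≡a) v≡b) }
      ... | no  v≢a = a , λ { _   (inj₁ (v≡a , _)) → v≢a v≡a
                            ; w≢a (inj₂ (_ , w≡a)) → w≢a w≡a }

      -- all degrees in S near v0 are at least three, so one can always
      -- continue avoiding both the previous vertex and the edge ab
      second-cycle : HCycle Other v0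
      second-cycle = cycle-from-branching Other proj₁ Other-sym S v0 branch v0∈S
        where
        branch : ∀ {v} → v ∈ S → Reach G v0 v → ∀ p → ∃ λ w → w ∈ S × Other v w × w ≢ p
        branch {v} v∈S rv p with partner v
        ... | q , q-ok with neighbour-avoiding S v (p ∷ q ∷ []) (≤-trans (s≤s (e≥2-near rv)) (dense v∈S))
        ...   | w , w∈S , vw , w≢p ∷ w≢q ∷ [] = w , w∈S , (vw , q-ok w≢q) , w≢p

    impossible : ⊥
    impossible with first-cycle | components v0
    ... | c1 , v0~c1 , _ | inj₁ tree = tree (c1 , v0~c1)
    ... | c1 , v0~c1 , _ | inj₂ (c , _ , unique) with cycle-edge G c1
    ...   | a , b , ab , c1ab = proj₂ (c2-avoids-ab (c-in-c2 (c1-in-c c1ab))) (inj₁ (refl , refl))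
      where
      a≢b : a ≢ b
      a≢b refl = irrefl ab
      e≥2-near : ∀ {v} → Reach G v0 v → 2 ≤ e v
      e≥2-near v0~v = cyclic⇒e≥2 c1 (reverse Adj-sym v0~v ◅◅ v0~c1)
      open WithoutEdge a b a≢b e≥2-near
      c2 : Cycle G
      c2 = proj₁ second-cycle
      -- both cycles are the unique cycle c of the component, as edge sets
      c1-in-c : CycleEdge G c1 a b → CycleEdge G c a b
      c1-in-c = proj₂ (unique c1 v0~c1 a b)
      c-in-c2 : CycleEdge G c a b → CycleEdge G c2 a b
      c-in-c2 = proj₁ (unique c2 (proj₁ (proj₂ second-cycle)) a b)
      c2-avoids-ab : CycleEdge G c2 a b → Other a b
      c2-avoids-ab = proj₂ (proj₂ second-cycle) a b

  sparse⇒degenerate : Degenerate e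
  sparse⇒degenerate S (v0 , v0∈S) with any? (λ v → (v ∈? S) ×-dec (deg S v ≤? e v))
  ... | yes (v , v∈S , low) = v , v∈S , low
  ... | no none = ⊥-elim (Dense.impossible S v0 v0∈S (λ v∈S → ≰⇒> (λ low → none (_ , v∈S , low))))

-- Degenerate orderings, built by peeling vertices of small degree.
module Orderings {n : ℕ} (G : Graph n) where
  open Graph G using (Adj; adj?; irrefl)
  open Neighbours G

  -- Reading t as peeling times: the neighbours of v in S peeled after v.
  Later : (Fin n → ℕ) → Subset n → Fin n → Subset n
  Later t S v = select (λ u → (u ∈? S) ×-dec (adj? v u ×-dec (t v <? t u)))

  Later⁺ : ∀ {t S v u} → u ∈ S → Adj v u → t v < t u → u ∈ Later t S v
  Later⁺ u∈S vu tvu = select⁺ _ (u∈S , vu , tvu)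

  Later⁻ : ∀ {t S v u} → u ∈ Later t S v → u ∈ S × Adj v u × t v < t u
  Later⁻ = select⁻ _

  record DegenerateOrdering (e : Fin n → ℕ) (S : Subset n) (t : Fin n → ℕ) : Set where
    field
      separates   : ∀ {u v} → u ∈ S → v ∈ S → Adj u v → t u ≢ t v
      later-bound : ∀ {v} → v ∈ S → ∣ Later t S v ∣ ≤ e v

  peel-first : Fin n → (Fin n → ℕ) → Fin n → ℕ
  peel-first v t u with u ≟ v
  ... | yes _ = 0
  ... | no  _ = suc (t u)

  peel-first-≡ : ∀ v t → peel-first v t v ≡ 0
  peel-first-≡ v t with v ≟ v
  ... | yes _   = refl
  ... | no  v≢v = contradiction refl v≢v

  peel-first-≢ : ∀ {v u} t → u ≢ v → peel-first v t u ≡ suc (t u)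
  peel-first-≢ {v} {u} t u≢v with u ≟ v
  ... | yes u≡v = contradiction u≡v u≢v
  ... | no  _   = refl

  peel-step : ∀ {e S v t} → v ∈ S → deg S v ≤ e v → DegenerateOrdering e (S - v) t →
              DegenerateOrdering e S (peel-first v t)
  peel-step {e} {S} {v} {t} v∈S low ord = record { separates = separates′ ; later-bound = later-bound′ }
    where
    open DegenerateOrdering ord
    t′ = peel-first v t

    separates′ : ∀ {u w} → u ∈ S → w ∈ S → Adj u w → t′ u ≢ t′ w
    separates′ {u} {w} u∈S w∈S uw with u ≟ v | w ≟ v
    ... | yes refl | yes refl = contradiction uw irrefl
    ... | yes refl | no _     = λ ()
    ... | no _     | yes refl = λ ()
    ... | no u≢v   | no w≢v   =
      separates (x∈p∧x≢y⇒x∈p-y u∈S u≢v) (x∈p∧x≢y⇒x∈p-y w∈S w≢v) uw ∘ suc-injective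

    later-of-v : Later t′ S v ⊆ Nbrs S v
    later-of-v u∈ = let u∈S , vu , _ = Later⁻ u∈ in select⁺ _ (u∈S , vu)

    -- any other vertex w: nothing is peeled before v, and the rest follows t
    later-of-other : ∀ {w} → w ≢ v → Later t′ S w ⊆ Later t (S - v) w
    later-of-other {w} w≢v {u} u∈ with Later⁻ u∈
    ... | u∈S , wu , tw<tu = by-cases (u ≟ v)
      where
      by-cases : Dec (u ≡ v) → u ∈ Later t (S - v) w
      by-cases (yes u≡v) = contradiction (subst (t′ w <_) (trans (cong t′ u≡v) (peel-first-≡ v t)) tw<tu) n≮0
      by-cases (no  u≢v) = Later⁺ (x∈p∧x≢y⇒x∈p-y u∈S u≢v) wu
                             (s≤s⁻¹ (subst₂ _<_ (peel-first-≢ t w≢v) (peel-first-≢ t u≢v) tw<tu))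

    later-bound′ : ∀ {w} → w ∈ S → ∣ Later t′ S w ∣ ≤ e w
    later-bound′ {w} w∈S = by-cases (w ≟ v)
      where
      by-cases : Dec (w ≡ v) → ∣ Later t′ S w ∣ ≤ e w
      by-cases (yes w≡v) = subst (λ x → ∣ Later t′ S x ∣ ≤ e x) (sym w≡v)
                             (≤-trans (p⊆q⇒∣p∣≤∣q∣ later-of-v) low)
      by-cases (no  w≢v) = ≤-trans (p⊆q⇒∣p∣≤∣q∣ (later-of-other w≢v))
                             (later-bound (x∈p∧x≢y⇒x∈p-y w∈S w≢v))

  degenerate⇒ordering : ∀ {e} → Degenerate e → ∀ S → ∃ (DegenerateOrdering e S)
  degenerate⇒ordering {e} degenerate S = go S (⊂-wellFounded S)
    where
    go : ∀ S → Acc _⊂_ S → ∃ (DegenerateOrdering e S)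
    go S (acc smaller) with nonempty? S
    ... | no empty = (λ _ → 0) , record { separates   = λ u∈S → contradiction (_ , u∈S) empty
                                        ; later-bound = λ v∈S → contradiction (_ , v∈S) empty }
    ... | yes nonempty with degenerate S nonempty
    ...   | v , v∈S , low with go (S - v) (smaller (x∈p⇒p-x⊂p v∈S))
    ...     | t , ord = peel-first v t , peel-step v∈S low ord

-- Mrs. Correct's answer in one round, against an ordering t of the vertices
-- (adjacent vertices getting different times): keep a set I of painted
-- vertices that is independent and such that each discarded painted vertex
-- has a kept neighbour peeled after it.
module Greedy {n : ℕ} (G : Graph n) (t : Fin n → ℕ) (separates : ∀ {u v} → Graph.Adj G u v → t u ≢ t v) where
  open Graph G using (Adj; adj?; irrefl) renaming (sym to Adj-sym)

  record Response (P I : Subset n) : Set where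
    field
      I⊆P         : I ⊆ P
      independent : Independent G I
      blocked     : ∀ {v} → v ∈ P → v ∉ I → ∃ λ u → u ∈ I × Adj v u × t v < t u

  earliest : ∀ P → Nonempty P → ∃ λ v → v ∈ P × (∀ {u} → u ∈ P → t v ≤ t u)
  earliest P (x , x∈P) = below (t x) x∈P ≤-refl
    where
    below : ∀ m {x} → x ∈ P → t x ≤ m → ∃ λ v → v ∈ P × (∀ {u} → u ∈ P → t v ≤ t u)
    below zero    {x} x∈P tx≤0 = x , x∈P , λ _ → ≤-trans tx≤0 z≤n
    below (suc m) {x} x∈P tx≤m with any? (λ y → (y ∈? P) ×-dec (t y ≤? m))
    ... | yes (y , y∈P , ty≤m) = below m y∈P ty≤m
    ... | no  none = x , x∈P , λ u∈P → ≤-trans tx≤m (≰⇒> (λ tu≤m → none (_ , u∈P , tu≤m)))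

  extend : ∀ {P v I} → v ∈ P → (∀ {u} → u ∈ P → t v ≤ t u) → Response (P - v) I → ∃ (Response P)
  extend {P} {v} {I} v∈P v-first resp with any? (λ u → (u ∈? I) ×-dec adj? v u)
  ... | yes (u , u∈I , vu) =
    I , record { I⊆P = p─q⊆p P ⁅ v ⁆ ∘ I⊆P ; independent = independent ; blocked = blocked′ }
    where
    open Response resp
    blocked′ : ∀ {w} → w ∈ P → w ∉ I → ∃ λ u → u ∈ I × Adj w u × t w < t u
    blocked′ {w} w∈P w∉I with w ≟ v
    ... | yes refl = u , u∈I , vu , ≤∧≢⇒< (v-first (p─q⊆p P ⁅ v ⁆ (I⊆P u∈I))) (separates vu)
    ... | no  w≢v  = blocked (x∈p∧x≢y⇒x∈p-y w∈P w≢v) w∉I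
  ... | no isolated = I ∪ ⁅ v ⁆ , record { I⊆P = I′⊆P ; independent = independent′ ; blocked = blocked′ }
    where
    open Response resp
    I′⊆P : I ∪ ⁅ v ⁆ ⊆ P
    I′⊆P x∈ with x∈p∪q⁻ I ⁅ v ⁆ x∈
    ... | inj₁ x∈I  = p─q⊆p P ⁅ v ⁆ (I⊆P x∈I)
    ... | inj₂ x∈v  = subst (_∈ P) (sym (x∈⁅y⁆⇒x≡y v x∈v)) v∈P
    independent′ : Independent G (I ∪ ⁅ v ⁆)
    independent′ x y x∈ y∈ xy with x∈p∪q⁻ I ⁅ v ⁆ x∈ | x∈p∪q⁻ I ⁅ v ⁆ y∈
    ... | inj₁ x∈I | inj₁ y∈I = independent x y x∈I y∈I xy
    ... | inj₁ x∈I | inj₂ y∈v with refl ← x∈⁅y⁆⇒x≡y v y∈v = isolated (x , x∈I , Adj-sym xy)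
    ... | inj₂ x∈v | inj₁ y∈I with refl ← x∈⁅y⁆⇒x≡y v x∈v = isolated (y , y∈I , xy)
    ... | inj₂ x∈v | inj₂ y∈v with refl ← x∈⁅y⁆⇒x≡y v x∈v | refl ← x∈⁅y⁆⇒x≡y v y∈v = irrefl xy
    blocked′ : ∀ {w} → w ∈ P → w ∉ I ∪ ⁅ v ⁆ → ∃ λ u → u ∈ I ∪ ⁅ v ⁆ × Adj w u × t w < t u
    blocked′ {w} w∈P w∉I′ with blocked (x∈p∧x≢y⇒x∈p-y w∈P w≢v) (w∉I′ ∘ p⊆p∪q ⁅ v ⁆)
      where
      w≢v : w ≢ v
      w≢v refl = w∉I′ (q⊆p∪q I ⁅ v ⁆ (x∈⁅x⁆ v))
    ... | u , u∈I , wu , tw<tu = u , p⊆p∪q ⁅ v ⁆ u∈I , wu , tw<tu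

  response : ∀ P → ∃ (Response P)
  response P = go P (⊂-wellFounded P)
    where
    go : ∀ P → Acc _⊂_ P → ∃ (Response P)
    go P (acc smaller) with nonempty? P
    ... | no empty = ∅ , record { I⊆P = λ x∈⊥ → contradiction x∈⊥ ∉⊥
                                ; independent = λ _ _ x∈⊥ → contradiction x∈⊥ ∉⊥
                                ; blocked = λ v∈P → contradiction (_ , v∈P) empty }
    ... | yes nonempty with earliest P nonempty
    ...   | v , v∈P , v-first with go (P - v) (smaller (x∈p⇒p-x⊂p v∈P))
    ...     | I , resp = extend v∈P v-first resp

useErasers-∈ : ∀ {n} (G : Graph n) {E e v} → v ∈ E → useErasers G E e v ≡ e v ∸ 1
useErasers-∈ G v∈E rewrite []=⇒lookup v∈E = refl

useErasers-∉ : ∀ {n} (G : Graph n) {E e v} → v ∉ E → useErasers G E e v ≡ e v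
useErasers-∉ G {E} {e} {v} v∉E with Vec.lookup E v in eq
... | true  = contradiction (lookup⇒[]= v E eq) v∉E
... | false = refl

useErasers-≤ : ∀ {n} (G : Graph n) E e v → useErasers G E e v ≤ e v
useErasers-≤ G E e v with Vec.lookup E v
... | true  = m∸n≤m (e v) 1
... | false = ≤-refl

module Game {n : ℕ} (G : Graph n) (t : Fin n → ℕ) (separates : ∀ {u v} → Graph.Adj G u v → t u ≢ t v) where
  open Graph G using (Adj)
  open Orderings G using (Later; Later⁺; Later⁻)
  open Greedy G t separates

  Invariant : Subset n → (Fin n → ℕ) → Set
  Invariant R e = ∀ {v} → v ∈ R → ∣ Later t R v ∣ ≤ e v

  -- each uncoloured vertex weighs one more than its number of erasers; every
  -- round strictly decreases the total weight
  weight : Subset n → (Fin n → ℕ) → Fin n → ℕ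
  weight R e v with v ∈? R
  ... | yes _ = suc (e v)
  ... | no  _ = 0

  weight-∈ : ∀ {R e v} → v ∈ R → weight R e v ≡ suc (e v)
  weight-∈ {R} {e} {v} v∈R with v ∈? R
  ... | yes _   = refl
  ... | no  v∉R = contradiction v∈R v∉R

  weight-∉ : ∀ {R e v} → v ∉ R → weight R e v ≡ 0
  weight-∉ {R} {e} {v} v∉R with v ∈? R
  ... | yes v∈R = contradiction v∈R v∉R
  ... | no  _   = refl

  potential : Subset n → (Fin n → ℕ) → ℕ
  potential R e = total (weight R e)

  module Round {R : Subset n} {e : Fin n → ℕ} (inv : Invariant R e) (P : Subset n) (P⊆R : P ⊆ R) where
    I : Subset n
    I = proj₁ (response P)
    open Response (proj₂ (response P))

    E : Subset n
    E = P ─ I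

    R′ : Subset n
    R′ = R ─ (P ─ E)

    e′ : Fin n → ℕ
    e′ = useErasers G E e

    kept⁻ : ∀ {x} → x ∈ P ─ E → x ∈ I
    kept⁻ {x} x∈ with x ∈? I
    ... | yes x∈I = x∈I
    ... | no  x∉I = contradiction (x∈p∧x∉q⇒x∈p─q (p─q⊆p P E x∈) x∉I) (x∈p─q⇒x∉q x∈)

    kept⁺ : ∀ {x} → x ∈ I → x ∈ P ─ E
    kept⁺ x∈I = x∈p∧x∉q⇒x∈p─q (I⊆P x∈I) (λ x∈E → x∈p─q⇒x∉q x∈E x∈I)

    R′⊆R : R′ ⊆ R
    R′⊆R = p─q⊆p R (P ─ E)

    kept-leave : ∀ {x} → x ∈ I → x ∉ R′
    kept-leave x∈I x∈R′ = x∈p─q⇒x∉q x∈R′ (kept⁺ x∈I)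

    erased-stay : ∀ {x} → x ∈ E → x ∈ R′
    erased-stay x∈E = x∈p∧x∉q⇒x∈p─q (P⊆R (p─q⊆p P I x∈E)) (λ x∈PE → x∈p─q⇒x∉q x∈E (kept⁻ x∈PE))

    erased-blocked : ∀ {v} → v ∈ E → ∃ λ u → u ∈ I × Adj v u × t v < t u
    erased-blocked v∈E = blocked (p─q⊆p P I v∈E) (x∈p─q⇒x∉q v∈E)

    -- so an erased vertex had a later uncoloured neighbour, hence an eraser
    has-eraser : ∀ v → v ∈ E → 1 ≤ e v
    has-eraser v v∈E = let u , u∈I , vu , tv<tu = erased-blocked v∈E in
      ≤-trans (x∈p⇒0<∣p∣ (Later⁺ (P⊆R (I⊆P u∈I)) vu tv<tu)) (inv (P⊆R (p─q⊆p P I v∈E)))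

    kept-independent : Independent G (P ─ E)
    kept-independent x y x∈ y∈ = independent x y (kept⁻ x∈) (kept⁻ y∈)

    Later-shrinks : ∀ v → Later t R′ v ⊆ Later t R v
    Later-shrinks v u∈ = let u∈R′ , vu , tv<tu = Later⁻ u∈ in Later⁺ (R′⊆R u∈R′) vu tv<tu

    -- an erased vertex loses a later neighbour exactly when it loses an eraser
    invariant : Invariant R′ e′
    invariant {v} v∈R′ with v ∈? E
    ... | yes v∈E = subst (∣ Later t R′ v ∣ ≤_) (sym (useErasers-∈ G {e = e} v∈E))
                      (<⇒≤∸1 (<-≤-trans fewer (inv (R′⊆R v∈R′))))
      where
      fewer : ∣ Later t R′ v ∣ < ∣ Later t R v ∣
      fewer with erased-blocked v∈E
      ... | u , u∈I , vu , tv<tu = p⊂q⇒∣p∣<∣q∣ (Later-shrinks v , u , Later⁺ (P⊆R (I⊆P u∈I)) vu tv<tu ,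
                                                 λ u∈L → kept-leave u∈I (proj₁ (Later⁻ u∈L)))
    ... | no v∉E = subst (∣ Later t R′ v ∣ ≤_) (sym (useErasers-∉ G {e = e} v∉E))
                     (≤-trans (p⊆q⇒∣p∣≤∣q∣ (Later-shrinks v)) (inv (R′⊆R v∈R′)))

    -- no vertex gets heavier, and painted vertices get lighter: they are
    -- either coloured or lose an eraser
    lighter : ∀ v → weight R′ e′ v ≤ weight R e v
    lighter v with v ∈? R′
    ... | yes v∈R′ = ≤-trans (s≤s (useErasers-≤ G E e v)) (≤-reflexive (sym (weight-∈ (R′⊆R v∈R′))))
    ... | no  _    = z≤n

    painted-lighter : ∀ {x} → x ∈ P → weight R′ e′ x < weight R e x
    painted-lighter {x} x∈P with x ∈? I
    ... | yes x∈I = subst₂ _<_ (sym (weight-∉ (kept-leave x∈I))) (sym (weight-∈ (P⊆R x∈P))) (s≤s z≤n)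
    ... | no  x∉I = subst₂ _<_ (sym (weight-∈ (erased-stay x∈E))) (sym (weight-∈ (P⊆R x∈P)))
                      (s≤s (subst (_< e x) (sym (useErasers-∈ G {e = e} x∈E)) (∸1< (has-eraser x x∈E))))
      where
      x∈E : x ∈ E
      x∈E = x∈p∧x∉q⇒x∈p─q x∈P x∉I

    progress : Nonempty P → potential R′ e′ < potential R e
    progress (x , x∈P) = total-strict lighter x (painted-lighter x∈P)

  wins : ∀ R e → Invariant R e → CorrectWins G R e
  wins R e = go R e (<-wellFounded (potential R e))
    where
    go : ∀ R e → Acc _<_ (potential R e) → Invariant R e → CorrectWins G R e
    go R e (acc smaller) inv = step λ P P⊆R painted →
      let open Round inv P P⊆R in
      E , p─q⊆p P I , has-eraser , kept-independent , go R′ e′ (smaller (progress painted)) invariant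

degenerate⇒CorrectWins : ∀ {n} (G : Graph n) (e : Fin n → ℕ) → Neighbours.Degenerate G e → CorrectWins G ⊤ e
degenerate⇒CorrectWins G e degenerate with Orderings.degenerate⇒ordering G degenerate ⊤
... | t , ordering = Game.wins G t (separates ∈⊤ ∈⊤) ⊤ e later-bound
  where open Orderings.DegenerateOrdering ordering

lemma5p1 : (n : ℕ) (G : Graph n) →
    (∀ v → TreeComponent G v ⊎ UnicyclicComponent G v) →
    (e : Fin n → ℕ) →
    (∀ v → (TreeComponent G v → e v ≡ 1) × (UnicyclicComponent G v → e v ≡ 2)) →
    CorrectWins G ⊤ e
-- The prescribed eraser numbers satisfy the hypotheses of SparseComponents.
lemma5p1 n G components e erasers =
  degenerate⇒CorrectWins G e (SparseComponents.sparse⇒degenerate G components e e≥1 e≥2)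
  where
  e≥2 : ∀ v → UnicyclicComponent G v → 2 ≤ e v
  e≥2 v unicyclic = ≤-reflexive (sym (proj₂ (erasers v) unicyclic))

  e≥1 : ∀ v → 1 ≤ e v
  e≥1 v with components v
  ... | inj₁ tree      = ≤-reflexive (sym (proj₁ (erasers v) tree))
  ... | inj₂ unicyclic = ≤-trans (s≤s z≤n) (e≥2 v unicyclic)
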